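{- For all integers $k\ge 2$ and $n\ge 1$, \[ \sum_{d\mid kn+1}\frac{\varphi(d)}{\operatorname{ord}_k(d)}=\frac{1}{\operatorname{ord}_k(kn+1)}\sum_{j=0}^{\operatorname{ord}_k(kn+1)-1}\gcd(k^j-1,\,kn+1). \]
   Context: $\varphi$ is Euler's totient function; for $d$ coprime to $k$, $\operatorname{ord}_k(d)$ is the least $\ell\ge1$ with $k^\ell\equiv1\pmod d$ (so $\operatorname{ord}_k(1)=1$). Convention: $\gcd(0,r)=r$ for $r\ge1$. (The left-hand side is denoted $i_k(kn+1)$ in the paper.) -}

module Defs where

open import Data.Nat using (ℕ; zero; suc; _+_; _*_; _∸_; _^_; _≟_; NonZero)
open import Data.Nat.DivMod using (_%_)
open import Data.Nat.GCD using (gcd)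
open import Data.Nat.Divisibility using (_∣?_)
open import Data.List using (List; []; _∷_; map; upTo; filter; length)
open import Data.Rational using (ℚ; 0ℚ)
open import Relation.Nullary.Decidable using (does)
open import Data.Bool using (if_then_else_)

divisors : ℕ → List ℕ
divisors m = filter (_∣? m) (map suc (upTo m))

φ : ℕ → ℕ
φ d = length (filter (λ i → gcd i d ≟ 1) (map suc (upTo d)))

-- search for the least ℓ in {s+1, …, s+fuel} with k^ℓ ≡ 1 (mod d);
-- returns ℓ ∸ 1 (so that the order is suc of the result, hence nonzero)
search : (k d : ℕ) → .{{NonZero d}} → (s fuel : ℕ) → ℕ
search k d s zero = 0
search k d s (suc fuel) =
  if does ((k ^ suc s) % d ≟ 1 % d) then s else search k d (suc s) fuel

ord-1 : ℕ → ℕ → ℕ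
ord-1 k zero = 0
ord-1 k (suc d) = search k (suc d) 0 (suc d)

-- multiplicative order of k modulo d (d ≥ 1, gcd(k,d) = 1):
-- the least ℓ ≥ 1 with k^ℓ ≡ 1 (mod d)  (so ord k 1 = 1).  Such ℓ satisfies
-- ℓ ≤ φ(d) ≤ d, so searching ℓ ∈ {1,…,d} suffices; the fallback value 1 is
-- only reached when d = 0 or k is not coprime to d (never in the statement).
ord : ℕ → ℕ → ℕ
ord k d = suc (ord-1 k d)

Σℚ : List ℚ → ℚ
Σℚ [] = 0ℚ
Σℚ (x ∷ xs) = x Data.Rational.+ Σℚ xs

Σℕ : List ℕ → ℕ
Σℕ [] = 0
Σℕ (x ∷ xs) = x Data.Nat.+ Σℕ xs

-- Write m = kn + 1 and L = ord_k(m). Gauss's identity g = ∑_{d ∣ g} φ(d), applied to g = gcd(k^j − 1, m),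
-- turns the right-hand sum into ∑_{d ∣ m} φ(d) · #{j < L : d ∣ k^j − 1}. For d ∣ m the condition
-- d ∣ k^j − 1 means ord_k(d) ∣ j, and ord_k(d) ∣ L, so the count is L / ord_k(d); dividing by L gives the
-- left-hand side.
module Submission where

open import Algebra.Properties.CommutativeSemigroup using (interchange)
open import Data.Bool using (if_then_else_)
open import Data.Fin using (toℕ; fromℕ<)
open import Data.Fin.Properties using (pigeonhole; toℕ-fromℕ<; toℕ<n)
import Data.Integer as ℤ
import Data.Integer.Properties as ℤ
open import Data.List using (List; []; _∷_; map; upTo; applyUpTo; filter; length)
open import Data.List.Properties using (map-∘; map-cong-local)
import Data.List.Relation.Unary.All as All
open import Data.List.Relation.Unary.All.Properties using (all-filter)
open import Data.Nat hiding (_/_)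
import Data.Nat as ℕ
open import Data.Nat.Coprimality using (Coprime; coprime-divisor)
open import Data.Nat.Divisibility
open import Data.Nat.DivMod hiding (_/_)
open import Data.Nat.GCD
open import Data.Nat.Properties
open import Data.Product using (_×_; _,_; proj₁; proj₂; Σ-syntax)
open import Data.Rational using (_/_; toℚᵘ)
import Data.Rational.Properties as ℚ
open import Data.Rational.Unnormalised using (mkℚᵘ; *≡*) renaming (_≃_ to _≃ᵘ_)
import Data.Rational.Unnormalised as ℚᵘ
import Data.Rational.Unnormalised.Properties as ℚᵘ
open import Data.Sum using (inj₁; inj₂)
open import Function using (_∘_; _⇔_; mk⇔; Equivalence)
open import Relation.Binary.PropositionalEquality
open import Relation.Nullary using (Dec; yes; no; ¬_; does; contradiction)
open import Relation.Nullary.Decidable using (_×-dec_)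

open import Defs

open Equivalence using (to; from)

∑ : ℕ → (ℕ → ℕ) → ℕ
∑ zero    f = 0
∑ (suc n) f = f 0 + ∑ n (f ∘ suc)

syntax ∑ n (λ i → e) = ∑[ i < n ] e

∑-cong : ∀ n {f g : ℕ → ℕ} → (∀ i → i < n → f i ≡ g i) → ∑ n f ≡ ∑ n g
∑-cong zero    eq = refl
∑-cong (suc n) eq = cong₂ _+_ (eq 0 z<s) (∑-cong n (λ i i<n → eq (suc i) (s<s i<n)))

∑-const : ∀ n c → ∑[ _ < n ] c ≡ n * c
∑-const zero    c = refl
∑-const (suc n) c = cong (c +_) (∑-const n c)

∑-zero : ∀ n {f : ℕ → ℕ} → (∀ i → i < n → f i ≡ 0) → ∑ n f ≡ 0
∑-zero n eq = trans (∑-cong n eq) (trans (∑-const n 0) (*-zeroʳ n))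

∑-split : ∀ m n (f : ℕ → ℕ) → ∑ (m + n) f ≡ ∑ m f + ∑[ i < n ] f (m + i)
∑-split zero    n f = refl
∑-split (suc m) n f = trans (cong (f 0 +_) (∑-split m n (f ∘ suc))) (sym (+-assoc (f 0) _ _))

∑-distrib-+ : ∀ n (f g : ℕ → ℕ) → ∑[ i < n ] (f i + g i) ≡ ∑ n f + ∑ n g
∑-distrib-+ zero    f g = refl
∑-distrib-+ (suc n) f g =
  trans (cong (f 0 + g 0 +_) (∑-distrib-+ n (f ∘ suc) (g ∘ suc)))
        (interchange +-commutativeSemigroup (f 0) (g 0) _ _)

∑-distribˡ-* : ∀ n c (f : ℕ → ℕ) → ∑[ i < n ] (c * f i) ≡ c * ∑ n f
∑-distribˡ-* zero    c f = sym (*-zeroʳ c)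
∑-distribˡ-* (suc n) c f =
  trans (cong (c * f 0 +_) (∑-distribˡ-* n c (f ∘ suc))) (sym (*-distribˡ-+ c (f 0) _))

∑-comm : ∀ m n (F : ℕ → ℕ → ℕ) → ∑[ i < m ] ∑[ j < n ] F i j ≡ ∑[ j < n ] ∑[ i < m ] F i j
∑-comm zero    n F = sym (∑-zero n (λ _ _ → refl))
∑-comm (suc m) n F =
  trans (cong (∑ n (F 0) +_) (∑-comm m n (F ∘ suc)))
        (sym (∑-distrib-+ n (F 0) (λ j → ∑[ i < m ] F (suc i) j)))

∑-single : ∀ n e (f : ℕ → ℕ) → e < n → (∀ i → i < n → i ≢ e → f i ≡ 0) → ∑ n f ≡ f e
∑-single (suc n) zero f _ others =
  trans (cong (f 0 +_) (∑-zero n (λ i i<n → others (suc i) (s<s i<n) (λ ())))) (+-identityʳ (f 0))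
∑-single (suc n) (suc e) f (s<s e<n) others =
  trans (cong (_+ ∑ n (f ∘ suc)) (others 0 z<s (λ ())))
        (∑-single n e (f ∘ suc) e<n (λ i i<n i≢e → others (suc i) (s<s i<n) (i≢e ∘ suc-injective)))

∑-rotate : ∀ n (f : ℕ → ℕ) → f 0 ≡ f n → ∑[ i < n ] f (suc i) ≡ ∑ n f
∑-rotate n f f0≡fn = +-cancelʳ-≡ (f 0) _ _ (begin
  ∑ n (f ∘ suc) + f 0     ≡⟨ +-comm (∑ n (f ∘ suc)) (f 0) ⟩
  ∑ (suc n) f             ≡⟨ cong (λ l → ∑ l f) (+-comm 1 n) ⟩
  ∑ (n + 1) f             ≡⟨ ∑-split n 1 f ⟩
  ∑ n f + (f (n + 0) + 0) ≡⟨ cong (∑ n f +_) (trans (+-identityʳ _) (cong f (+-identityʳ n))) ⟩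
  ∑ n f + f n             ≡⟨ cong (∑ n f +_) f0≡fn ⟨
  ∑ n f + f 0             ∎)
  where open ≡-Reasoning

∑-multiples : ∀ c q .{{_ : NonZero c}} (F : ℕ → ℕ) → (∀ x → ¬ c ∣ x → F x ≡ 0) →
              ∑ (q * c) F ≡ ∑[ y < q ] F (c * y)
∑-multiples c zero    F _        = refl
∑-multiples c (suc q) F vanishes = begin
  ∑ (c + q * c) F                       ≡⟨ ∑-split c (q * c) F ⟩
  ∑ c F + ∑[ i < q * c ] F (c + i)      ≡⟨ cong₂ _+_ first (∑-multiples c q (F ∘ (c +_)) vanishes′) ⟩
  F (c * 0) + ∑[ y < q ] F (c + c * y)  ≡⟨ cong (F (c * 0) +_) (∑-cong q (λ y _ → cong F (*-suc c y))) ⟨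
  ∑[ y < suc q ] F (c * y)              ∎
  where
  open ≡-Reasoning
  first : ∑ c F ≡ F (c * 0)
  first = trans (∑-single c 0 F (>-nonZero⁻¹ c) λ i i<c i≢0 → vanishes i (i≢0 ∘ m<n⇒n∣m⇒m≡0 i<c))
                (cong F (sym (*-zeroʳ c)))
    where
    m<n⇒n∣m⇒m≡0 : ∀ {i} → i < c → c ∣ i → i ≡ 0
    m<n⇒n∣m⇒m≡0 {zero}  _   _   = refl
    m<n⇒n∣m⇒m≡0 {suc i} i<c c∣i = contradiction (∣⇒≤ c∣i) (<⇒≱ i<c)
  vanishes′ : ∀ x → ¬ c ∣ x → F (c + x) ≡ 0
  vanishes′ x c∤x = vanishes (c + x) (λ c∣c+x → c∤x (∣m+n∣m⇒∣n c∣c+x ∣-refl))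

Σℕ-applyUpTo : ∀ (h f : ℕ → ℕ) n → Σℕ (map h (applyUpTo f n)) ≡ ∑ n (h ∘ f)
Σℕ-applyUpTo h f zero    = refl
Σℕ-applyUpTo h f (suc n) = cong (h (f 0) +_) (Σℕ-applyUpTo h (f ∘ suc) n)

Σℕ-upTo : ∀ (h : ℕ → ℕ) n → Σℕ (map h (upTo n)) ≡ ∑ n h
Σℕ-upTo h = Σℕ-applyUpTo h (λ i → i)

guard : ∀ {p} {P : Set p} → Dec P → ℕ → ℕ
guard (yes _) x = x
guard (no  _) _ = 0

module _ {p} {P : Set p} where

  guard-yes : (P? : Dec P) → P → ∀ x → guard P? x ≡ x
  guard-yes (yes _)  _  x = refl
  guard-yes (no ¬p) pr x = contradiction pr ¬p

  guard-no : (P? : Dec P) → ¬ P → ∀ x → guard P? x ≡ 0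
  guard-no (yes pr) ¬p x = contradiction pr ¬p
  guard-no (no _)   _  x = refl

  guard-congʳ : (P? : Dec P) {x y : ℕ} → (P → x ≡ y) → guard P? x ≡ guard P? y
  guard-congʳ (yes pr) eq = eq pr
  guard-congʳ (no _)   eq = refl

  guard-⇔ : ∀ {q} {Q : Set q} (P? : Dec P) (Q? : Dec Q) → P ⇔ Q → ∀ x → guard P? x ≡ guard Q? x
  guard-⇔ P? Q? P⇔Q x with P? | Q?
  ... | yes _  | yes _  = refl
  ... | yes pr | no ¬q  = contradiction (to P⇔Q pr) ¬q
  ... | no ¬p  | yes q  = contradiction (from P⇔Q q) ¬p
  ... | no _   | no _   = refl

  guard-×-dec : ∀ {q} {Q : Set q} (P? : Dec P) (Q? : Dec Q) x → guard (P? ×-dec Q?) x ≡ guard P? (guard Q? x)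
  guard-×-dec (yes _) (yes _) x = refl
  guard-×-dec (yes _) (no _)  x = refl
  guard-×-dec (no _)  _       x = refl

  guard-0 : (P? : Dec P) → guard P? 0 ≡ 0
  guard-0 (yes _) = refl
  guard-0 (no _)  = refl

  guard-* : (P? : Dec P) → ∀ x → guard P? x ≡ x * guard P? 1
  guard-* (yes _) x = sym (*-identityʳ x)
  guard-* (no _)  x = sym (*-zeroʳ x)

  guard-∑ : (P? : Dec P) → ∀ n (f : ℕ → ℕ) → guard P? (∑ n f) ≡ ∑[ i < n ] guard P? (f i)
  guard-∑ (yes _) n f = refl
  guard-∑ (no _)  n f = sym (∑-zero n (λ _ _ → refl))

Σℕ-filter : ∀ {p} {P : ℕ → Set p} (P? : ∀ x → Dec (P x)) (F : ℕ → ℕ) xs →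
            Σℕ (map F (filter P? xs)) ≡ Σℕ (map (λ x → guard (P? x) (F x)) xs)
Σℕ-filter P? F []       = refl
Σℕ-filter P? F (x ∷ xs) with P? x
... | yes _ = cong (F x +_) (Σℕ-filter P? F xs)
... | no  _ = Σℕ-filter P? F xs

Σℕ-filter-suc-upTo : ∀ {p} {P : ℕ → Set p} (P? : ∀ x → Dec (P x)) (F : ℕ → ℕ) n →
                     Σℕ (map F (filter P? (map suc (upTo n)))) ≡ ∑[ i < n ] guard (P? (suc i)) (F (suc i))
Σℕ-filter-suc-upTo P? F n = begin
  Σℕ (map F (filter P? (map suc (upTo n))))               ≡⟨ Σℕ-filter P? F (map suc (upTo n)) ⟩
  Σℕ (map (λ x → guard (P? x) (F x)) (map suc (upTo n)))  ≡⟨ cong Σℕ (map-∘ (upTo n)) ⟨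
  Σℕ (map (λ i → guard (P? (suc i)) (F (suc i))) (upTo n)) ≡⟨ Σℕ-upTo _ n ⟩
  ∑[ i < n ] guard (P? (suc i)) (F (suc i))               ∎
  where open ≡-Reasoning

length≡Σℕ-1 : ∀ {a} {A : Set a} (xs : List A) → length xs ≡ Σℕ (map (λ _ → 1) xs)
length≡Σℕ-1 []       = refl
length≡Σℕ-1 (x ∷ xs) = cong suc (length≡Σℕ-1 xs)

Σℕ-divisors : ∀ m (F : ℕ → ℕ) → Σℕ (map F (divisors m)) ≡ ∑[ e < m ] guard (suc e ∣? m) (F (suc e))
Σℕ-divisors m F = Σℕ-filter-suc-upTo (_∣? m) F m

φ≡∑coprime : ∀ n → φ n ≡ ∑[ y < n ] guard (gcd y n ≟ 1) 1
φ≡∑coprime n = begin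
  length (filter P? (map suc (upTo n)))             ≡⟨ length≡Σℕ-1 (filter P? (map suc (upTo n))) ⟩
  Σℕ (map (λ _ → 1) (filter P? (map suc (upTo n)))) ≡⟨ Σℕ-filter-suc-upTo P? (λ _ → 1) n ⟩
  ∑[ y < n ] guard (P? (suc y)) 1                   ≡⟨ ∑-rotate n (λ y → guard (P? y) 1) ends ⟩
  ∑[ y < n ] guard (P? y) 1                         ∎
  where
  open ≡-Reasoning
  P? = λ i → gcd i n ≟ 1
  ends : guard (P? 0) 1 ≡ guard (P? n) 1
  ends = cong (λ g → guard (g ≟ 1) 1)
              (trans (gcd-identityˡ n) (∣-antisym (gcd-greatest ∣-refl ∣-refl) (gcd[m,n]∣m n n)))

-- The x < c·e with gcd(x, ce) = c are the multiples c·y with gcd(y, e) = 1.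
φ≡#gcd : ∀ {e g} .{{_ : NonZero g}} → e ∣ g → φ e ≡ ∑[ x < g ] guard (e * gcd x g ≟ g) 1
φ≡#gcd {e} {g@.(c * e)} (divides-refl c) = begin
  φ e                                     ≡⟨ φ≡∑coprime e ⟩
  ∑[ y < e ] guard (gcd y e ≟ 1) 1        ≡⟨ ∑-cong e (λ y _ → guard-⇔ _ _ (scaled y) 1) ⟨
  ∑[ y < e ] F (c * y)                    ≡⟨ ∑-multiples c e F vanishes ⟨
  ∑ (e * c) F                             ≡⟨ cong (λ n → ∑ n F) (*-comm e c) ⟩
  ∑ g F                                   ∎
  where
  open ≡-Reasoning
  instance
    _ : NonZero c
    _ = m*n≢0⇒m≢0 c
    _ : NonZero e
    _ = m*n≢0⇒n≢0 c
  F = λ x → guard (e * gcd x g ≟ g) 1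
  e*gcd : ∀ y → e * gcd (c * y) g ≡ g * gcd y e
  e*gcd y = begin
    e * gcd (c * y) (c * e) ≡⟨ cong (e *_) (c*gcd[m,n]≡gcd[cm,cn] c y e) ⟨
    e * (c * gcd y e)       ≡⟨ *-assoc e c _ ⟨
    e * c * gcd y e         ≡⟨ cong (_* gcd y e) (*-comm e c) ⟩
    g * gcd y e             ∎
  scaled : ∀ y → (e * gcd (c * y) g ≡ g) ⇔ (gcd y e ≡ 1)
  scaled y = mk⇔ (λ eq → *-cancelˡ-≡ _ 1 g (trans (sym (e*gcd y)) (trans eq (sym (*-identityʳ g)))))
                 (λ eq → trans (e*gcd y) (trans (cong (g *_) eq) (*-identityʳ g)))
  vanishes : ∀ x → ¬ c ∣ x → F x ≡ 0
  vanishes x c∤x = guard-no _ (λ eq → c∤x (subst (_∣ x) (gcd≡c eq) (gcd[m,n]∣m x g))) 1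
    where
    gcd≡c : e * gcd x g ≡ g → gcd x g ≡ c
    gcd≡c eq = *-cancelˡ-≡ _ c e (trans eq (*-comm c e))

∑-unique-divisor : ∀ x {g} m .{{_ : NonZero g}} → g ≤ m →
                   ∑[ e < m ] guard (suc e ∣? g) (guard (suc e * gcd x g ≟ g) 1) ≡ 1
∑-unique-divisor x {g} m g≤m with gcd[m,n]∣n x g
... | divides zero    g≡0       = contradiction g≡0 (≢-nonZero⁻¹ g)
... | divides (suc e) g≡[1+e]*c =
  trans (∑-single m e _ e<m others)
        (trans (guard-yes (suc e ∣? g) (divides c (trans g≡[1+e]*c (*-comm (suc e) c))) _)
               (guard-yes (suc e * c ≟ g) (sym g≡[1+e]*c) 1))
  where
  c = gcd x g
  instance
    _ : NonZero c
    _ = ≢-nonZero (gcd[m,n]≢0 x g (inj₂ (≢-nonZero⁻¹ g)))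
  e<m : e < m
  e<m = <-≤-trans (subst (e <_) (sym g≡[1+e]*c) (m≤m*n (suc e) c)) g≤m
  others : ∀ i → i < m → i ≢ e → guard (suc i ∣? g) (guard (suc i * c ≟ g) 1) ≡ 0
  others i _ i≢e = trans (cong (guard (suc i ∣? g)) (guard-no (suc i * c ≟ g) i*c≢g 1)) (guard-0 (suc i ∣? g))
    where
    i*c≢g : suc i * c ≢ g
    i*c≢g eq = i≢e (suc-injective (*-cancelʳ-≡ _ _ c (trans eq g≡[1+e]*c)))

-- Gauss's identity, by sorting the x < g according to g / gcd(x, g).
∑φ-divisors : ∀ {g} m .{{_ : NonZero g}} → g ≤ m → ∑[ e < m ] guard (suc e ∣? g) (φ (suc e)) ≡ g
∑φ-divisors {g} m g≤m = begin
  ∑[ e < m ] guard (suc e ∣? g) (φ (suc e))         ≡⟨ ∑-cong m (λ e _ → guard-congʳ (suc e ∣? g) φ≡#gcd) ⟩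
  ∑[ e < m ] guard (suc e ∣? g) (∑[ x < g ] F e x)  ≡⟨ ∑-cong m (λ e _ → guard-∑ (suc e ∣? g) g (F e)) ⟩
  ∑[ e < m ] ∑[ x < g ] guard (suc e ∣? g) (F e x)  ≡⟨ ∑-comm m g _ ⟩
  ∑[ x < g ] ∑[ e < m ] guard (suc e ∣? g) (F e x)  ≡⟨ ∑-cong g (λ x _ → ∑-unique-divisor x m g≤m) ⟩
  ∑[ _ < g ] 1                                      ≡⟨ ∑-const g 1 ⟩
  g * 1                                             ≡⟨ *-identityʳ g ⟩
  g                                                 ∎
  where
  open ≡-Reasoning
  F = λ e x → guard (suc e * gcd x g ≟ g) 1

gcd≡∑φ : ∀ a m .{{_ : NonZero m}} →
         gcd a m ≡ ∑[ e < m ] guard (suc e ∣? m) (guard (suc e ∣? a) (φ (suc e)))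
gcd≡∑φ a m = trans (sym (∑φ-divisors m (gcd[m,n]≤n a m))) (∑-cong m (λ e _ →
  trans (guard-⇔ (suc e ∣? gcd a m) (suc e ∣? m ×-dec suc e ∣? a) (∣gcd⇔ (suc e)) (φ (suc e)))
        (guard-×-dec (suc e ∣? m) (suc e ∣? a) (φ (suc e)))))
  where
  instance
    _ : NonZero (gcd a m)
    _ = ≢-nonZero (gcd[m,n]≢0 a m (inj₂ (≢-nonZero⁻¹ m)))
  ∣gcd⇔ : ∀ d → d ∣ gcd a m ⇔ (d ∣ m × d ∣ a)
  ∣gcd⇔ d = mk⇔ (λ d∣g → ∣-trans d∣g (gcd[m,n]∣n a m) , ∣-trans d∣g (gcd[m,n]∣m a m))
                (λ (d∣m , d∣a) → gcd-greatest d∣a d∣m)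

∑-count-multiples : ∀ o q .{{_ : NonZero o}} {p} {P : ℕ → Set p} (P? : ∀ j → Dec (P j)) →
                    (∀ j → P j ⇔ o ∣ j) → ∑[ j < q * o ] guard (P? j) 1 ≡ q
∑-count-multiples o q P? P⇔o∣ = begin
  ∑[ j < q * o ] guard (P? j) 1    ≡⟨ ∑-multiples o q _ (λ j o∤j → guard-no (P? j) (o∤j ∘ to (P⇔o∣ j)) 1) ⟩
  ∑[ y < q ] guard (P? (o * y)) 1  ≡⟨ ∑-cong q (λ y _ → guard-yes (P? (o * y)) (from (P⇔o∣ _) (m∣m*n y)) 1) ⟩
  ∑[ _ < q ] 1                     ≡⟨ ∑-const q 1 ⟩
  q * 1                            ≡⟨ *-identityʳ q ⟩
  q                                ∎
  where open ≡-Reasoning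

%≡%⇒∣∸ : ∀ {m n d} .{{_ : NonZero d}} → m % d ≡ n % d → d ∣ m ∸ n
%≡%⇒∣∸ {m} {n} {d} eq = divides (m ℕ./ d ∸ n ℕ./ d) (begin
  m ∸ n                                         ≡⟨ cong₂ _∸_ (m≡m%n+[m/n]*n m d) (m≡m%n+[m/n]*n n d) ⟩
  (m % d + m ℕ./ d * d) ∸ (n % d + n ℕ./ d * d) ≡⟨ cong (λ r → r + m ℕ./ d * d ∸ (n % d + n ℕ./ d * d)) eq ⟩
  (n % d + m ℕ./ d * d) ∸ (n % d + n ℕ./ d * d) ≡⟨ [m+n]∸[m+o]≡n∸o (n % d) _ _ ⟩
  m ℕ./ d * d ∸ n ℕ./ d * d                     ≡⟨ *-distribʳ-∸ d (m ℕ./ d) (n ℕ./ d) ⟨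
  (m ℕ./ d ∸ n ℕ./ d) * d                       ∎)
  where open ≡-Reasoning

∣∸⇒%≡% : ∀ {m n d} .{{_ : NonZero d}} → n ≤ m → d ∣ m ∸ n → m % d ≡ n % d
∣∸⇒%≡% {m} {n} {d} n≤m (divides q m∸n≡q*d) = begin
  m % d               ≡⟨ cong (_% d) (m+[n∸m]≡n n≤m) ⟨
  (n + (m ∸ n)) % d   ≡⟨ cong (λ r → (n + r) % d) m∸n≡q*d ⟩
  (n + q * d) % d     ≡⟨ [m+kn]%n≡m%n n q d ⟩
  n % d               ∎
  where open ≡-Reasoning

*-∸1 : ∀ m n .{{_ : NonZero m}} .{{_ : NonZero n}} → m * n ∸ 1 ≡ (m ∸ 1) * n + (n ∸ 1)
*-∸1 (suc m) (suc n) = +-comm n (m * suc n)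

coprime-divisor-^ : ∀ {d k x} → Coprime d k → ∀ a → d ∣ k ^ a * x → d ∣ x
coprime-divisor-^ {d} {k} {x} d⊥k zero    d∣ = subst (d ∣_) (+-identityʳ x) d∣
coprime-divisor-^ {d} {k} {x} d⊥k (suc a) d∣ =
  coprime-divisor-^ d⊥k a (coprime-divisor d⊥k (subst (d ∣_) (*-assoc k (k ^ a) x) d∣))

module _ {d k : ℕ} .{{_ : NonZero k}} where

  private
    ^∸1-+ : ∀ m n → k ^ (m + n) ∸ 1 ≡ (k ^ m ∸ 1) * k ^ n + (k ^ n ∸ 1)
    ^∸1-+ m n = trans (cong (_∸ 1) (^-distribˡ-+-* k m n)) (*-∸1 (k ^ m) (k ^ n) {{m^n≢0 k m}} {{m^n≢0 k n}})

  ∣^∸1-+ : ∀ {m n} → d ∣ k ^ m ∸ 1 → d ∣ k ^ n ∸ 1 → d ∣ k ^ (m + n) ∸ 1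
  ∣^∸1-+ {m} {n} d∣m d∣n = subst (d ∣_) (sym (^∸1-+ m n)) (∣m∣n⇒∣m+n (∣m⇒∣m*n (k ^ n) d∣m) d∣n)

  ∣^∸1-+⁻ : ∀ {m n} → d ∣ k ^ m ∸ 1 → d ∣ k ^ (m + n) ∸ 1 → d ∣ k ^ n ∸ 1
  ∣^∸1-+⁻ {m} {n} d∣m d∣m+n = ∣m+n∣m⇒∣n (subst (d ∣_) (^∸1-+ m n) d∣m+n) (∣m⇒∣m*n (k ^ n) d∣m)

  ∣^∸1-* : ∀ {m} → d ∣ k ^ m ∸ 1 → ∀ q → d ∣ k ^ (q * m) ∸ 1
  ∣^∸1-*     d∣m zero    = d ∣0
  ∣^∸1-* {m} d∣m (suc q) = ∣^∸1-+ {m} {q * m} d∣m (∣^∸1-* d∣m q)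

ord-1≡search : ∀ k d .{{_ : NonZero d}} → ord-1 k d ≡ search k d 0 d
ord-1≡search k (suc d) = refl

module Order (k d : ℕ) .{{_ : NonZero k}} .{{_ : NonZero d}} (d⊥k : Coprime d k) where

  private
    ∣^∸1⇒%≡ : ∀ ℓ → d ∣ k ^ ℓ ∸ 1 → k ^ ℓ % d ≡ 1 % d
    ∣^∸1⇒%≡ ℓ = ∣∸⇒%≡% (m^n>0 k ℓ)

    FirstFrom : ℕ → ℕ → Set
    FirstFrom s r = s ≤ r × d ∣ k ^ suc r ∸ 1 × (∀ l → s ≤ l → l < r → ¬ d ∣ k ^ suc l ∸ 1)

    search-first : ∀ s fuel ℓ → s < ℓ → ℓ ≤ s + fuel → d ∣ k ^ ℓ ∸ 1 → FirstFrom s (search k d s fuel)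
    search-first s zero ℓ s<ℓ ℓ≤s+0 _ = contradiction (subst (ℓ ≤_) (+-identityʳ s) ℓ≤s+0) (<⇒≱ s<ℓ)
    search-first s (suc fuel) ℓ s<ℓ ℓ≤s+1+fuel d∣ℓ = step ((k ^ suc s) % d ≟ 1 % d)
      where
      step : (hit? : Dec (k ^ suc s % d ≡ 1 % d)) →
             FirstFrom s (if does hit? then s else search k d (suc s) fuel)
      step (yes hit) = ≤-refl , %≡%⇒∣∸ hit , λ l s≤l l<s → contradiction s≤l (<⇒≱ l<s)
      step (no miss) with search-first (suc s) fuel ℓ 1+s<ℓ (subst (ℓ ≤_) (+-suc s fuel) ℓ≤s+1+fuel) d∣ℓ
        where
        1+s<ℓ : suc s < ℓ
        1+s<ℓ with m≤n⇒m<n∨m≡n s<ℓ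
        ... | inj₁ 1+s<ℓ = 1+s<ℓ
        ... | inj₂ refl  = contradiction (∣^∸1⇒%≡ ℓ d∣ℓ) miss
      ... | 1+s≤r , hit , earlier = ≤-trans (n≤1+n s) 1+s≤r , hit , earlier′
        where
        earlier′ : ∀ l → s ≤ l → l < _ → ¬ d ∣ k ^ suc l ∸ 1
        earlier′ l s≤l l<r with m≤n⇒m<n∨m≡n s≤l
        ... | inj₁ s<l = earlier l s<l l<r
        ... | inj₂ refl = miss ∘ ∣^∸1⇒%≡ (suc s)

    -- Among k¹, …, k^(d+1) two are congruent mod d; since d ⊥ k their exponent difference ℓ has d ∣ k^ℓ − 1.
    period≤d : Σ[ ℓ ∈ ℕ ] 0 < ℓ × ℓ ≤ d × d ∣ k ^ ℓ ∸ 1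
    period≤d with pigeonhole (n<1+n d) (λ i → fromℕ< (m%n<n (k ^ suc (toℕ i)) d))
    ... | i , j , i<j , same-residue = ℓ , m<n⇒0<n∸m i<j , ℓ≤d , coprime-divisor-^ d⊥k a d∣k^a*[k^ℓ∸1]
      where
      a = suc (toℕ i)
      ℓ = toℕ j ∸ toℕ i
      ℓ≤d : ℓ ≤ d
      ℓ≤d = ≤-trans (m∸n≤m (toℕ j) (toℕ i)) (≤-pred (toℕ<n j))
      k^[a+ℓ]≡k^a*k^ℓ : k ^ (a + ℓ) ≡ k ^ a * k ^ ℓ
      k^[a+ℓ]≡k^a*k^ℓ = ^-distribˡ-+-* k a ℓ
      a+ℓ≡1+j : a + ℓ ≡ suc (toℕ j)
      a+ℓ≡1+j = cong suc (m+[n∸m]≡n (<⇒≤ i<j))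
      residues : k ^ (a + ℓ) % d ≡ k ^ a % d
      residues = begin
        k ^ (a + ℓ) % d                                 ≡⟨ cong (λ b → k ^ b % d) a+ℓ≡1+j ⟩
        k ^ suc (toℕ j) % d                             ≡⟨ toℕ-fromℕ< _ ⟨
        toℕ (fromℕ< (m%n<n (k ^ suc (toℕ j)) d))        ≡⟨ cong toℕ same-residue ⟨
        toℕ (fromℕ< (m%n<n (k ^ a) d))                  ≡⟨ toℕ-fromℕ< _ ⟩
        k ^ a % d                                       ∎
        where open ≡-Reasoning
      d∣k^a*[k^ℓ∸1] : d ∣ k ^ a * (k ^ ℓ ∸ 1)
      d∣k^a*[k^ℓ∸1] = subst (d ∣_) (begin
        k ^ (a + ℓ) ∸ k ^ a           ≡⟨ cong₂ _∸_ k^[a+ℓ]≡k^a*k^ℓ (sym (*-identityʳ (k ^ a))) ⟩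
        k ^ a * k ^ ℓ ∸ k ^ a * 1     ≡⟨ *-distribˡ-∸ (k ^ a) (k ^ ℓ) 1 ⟨
        k ^ a * (k ^ ℓ ∸ 1)           ∎) (%≡%⇒∣∸ residues)
        where open ≡-Reasoning

    ord-first : FirstFrom 0 (ord-1 k d)
    ord-first = subst (FirstFrom 0) (sym (ord-1≡search k d)) (search-first 0 d ℓ 0<ℓ ℓ≤d d∣ℓ)
      where
      ℓ = proj₁ period≤d
      0<ℓ = proj₁ (proj₂ period≤d)
      ℓ≤d = proj₁ (proj₂ (proj₂ period≤d))
      d∣ℓ = proj₂ (proj₂ (proj₂ period≤d))

  ∣k^ord∸1 : d ∣ k ^ ord k d ∸ 1
  ∣k^ord∸1 = proj₁ (proj₂ ord-first)

  ord-least : ∀ ℓ → ℓ < ord k d → d ∣ k ^ ℓ ∸ 1 → ℓ ≡ 0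
  ord-least zero    _         _   = refl
  ord-least (suc l) (s<s l<o) d∣ℓ = contradiction d∣ℓ (proj₂ (proj₂ ord-first) l z≤n l<o)

  ∣k^∸1⇔ord∣ : ∀ j → d ∣ k ^ j ∸ 1 ⇔ ord k d ∣ j
  ∣k^∸1⇔ord∣ j = mk⇔ ord∣ (λ { (divides-refl q) → ∣^∸1-* ∣k^ord∸1 q })
    where
    o = ord k d
    ord∣ : d ∣ k ^ j ∸ 1 → o ∣ j
    ord∣ d∣j = m%n≡0⇒n∣m j o (ord-least (j % o) (m%n<n j o) d∣k^[j%o]∸1)
      where
      j≡[j/o]*o+j%o : j ≡ j ℕ./ o * o + j % o
      j≡[j/o]*o+j%o = trans (m≡m%n+[m/n]*n j o) (+-comm (j % o) _)
      d∣k^[j%o]∸1 : d ∣ k ^ (j % o) ∸ 1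
      d∣k^[j%o]∸1 = ∣^∸1-+⁻ {m = j ℕ./ o * o} (∣^∸1-* {m = o} ∣k^ord∸1 (j ℕ./ o))
                              (subst (λ i → d ∣ k ^ i ∸ 1) j≡[j/o]*o+j%o d∣j)

  ∑-powers≡1 : ∀ L → ord k d ∣ L → ∑[ j < L ] guard (d ∣? k ^ j ∸ 1) 1 ≡ L ℕ./ ord k d
  ∑-powers≡1 L o∣L = begin
    count L             ≡⟨ cong count (m/n*n≡m o∣L) ⟨
    count (L ℕ./ o * o) ≡⟨ ∑-count-multiples o (L ℕ./ o) (λ j → d ∣? k ^ j ∸ 1) ∣k^∸1⇔ord∣ ⟩
    L ℕ./ o             ∎
    where
    open ≡-Reasoning
    o = ord k d
    count = λ n → ∑[ j < n ] guard (d ∣? k ^ j ∸ 1) 1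

divisor-coprime : ∀ {d m k} → Coprime m k → d ∣ m → Coprime d k
divisor-coprime m⊥k d∣m (i∣d , i∣k) = m⊥k (∣-trans i∣d d∣m , i∣k)

ord∣ord : ∀ k {d m} .{{_ : NonZero k}} .{{_ : NonZero d}} .{{_ : NonZero m}} →
          Coprime m k → d ∣ m → ord k d ∣ ord k m
ord∣ord k {d} {m} m⊥k d∣m =
  to (Order.∣k^∸1⇔ord∣ k d (divisor-coprime m⊥k d∣m) _) (∣-trans d∣m (Order.∣k^ord∸1 k m m⊥k))

Σgcd≡Σφ*[ord/ord] : ∀ k m .{{_ : NonZero k}} .{{_ : NonZero m}} → Coprime m k →
  Σℕ (map (λ j → gcd (k ^ j ∸ 1) m) (upTo (ord k m)))
    ≡ Σℕ (map (λ d → φ d * (ord k m ℕ./ ord k d)) (divisors m))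
Σgcd≡Σφ*[ord/ord] k m m⊥k = begin
  Σℕ (map (λ j → gcd (k ^ j ∸ 1) m) (upTo L))   ≡⟨ Σℕ-upTo _ L ⟩
  ∑[ j < L ] gcd (k ^ j ∸ 1) m                  ≡⟨ ∑-cong L (λ j _ → gcd≡∑φ (k ^ j ∸ 1) m) ⟩
  ∑[ j < L ] ∑[ e < m ] F e j                   ≡⟨ ∑-comm L m (λ j e → F e j) ⟩
  ∑[ e < m ] ∑[ j < L ] F e j                   ≡⟨ ∑-cong m (λ e _ → ∑-over-period e) ⟩
  ∑[ e < m ] guard (suc e ∣? m) (G (suc e))     ≡⟨ Σℕ-divisors m G ⟨
  Σℕ (map G (divisors m))                       ∎
  where
  open ≡-Reasoning
  L = ord k m
  F = λ e j → guard (suc e ∣? m) (guard (suc e ∣? k ^ j ∸ 1) (φ (suc e)))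
  G = λ d → φ d * (L ℕ./ ord k d)
  ∑-for-divisor : ∀ {d} .{{_ : NonZero d}} → d ∣ m → ∑[ j < L ] guard (d ∣? k ^ j ∸ 1) (φ d) ≡ G d
  ∑-for-divisor {d} d∣m = begin
    ∑[ j < L ] guard (d ∣? k ^ j ∸ 1) (φ d)       ≡⟨ ∑-cong L (λ j _ → guard-* (d ∣? k ^ j ∸ 1) (φ d)) ⟩
    ∑[ j < L ] (φ d * guard (d ∣? k ^ j ∸ 1) 1)   ≡⟨ ∑-distribˡ-* L (φ d) (λ j → guard (d ∣? k ^ j ∸ 1) 1) ⟩
    φ d * ∑[ j < L ] guard (d ∣? k ^ j ∸ 1) 1
      ≡⟨ cong (φ d *_) (Order.∑-powers≡1 k d d⊥k L (ord∣ord k m⊥k d∣m)) ⟩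
    G d                                           ∎
    where d⊥k = divisor-coprime m⊥k d∣m
  ∑-over-period : ∀ e → ∑[ j < L ] F e j ≡ guard (suc e ∣? m) (G (suc e))
  ∑-over-period e = trans (sym (guard-∑ (suc e ∣? m) L (λ j → guard (suc e ∣? k ^ j ∸ 1) (φ (suc e)))))
                          (guard-congʳ (suc e ∣? m) ∑-for-divisor)

-- Opened only here: the prefix +_ would make sections such as (c +_) above ambiguous.
open import Data.Integer using (+_)

mkℚᵘ-cross : ∀ a b c d → a * suc d ≡ c * suc b → mkℚᵘ (+ a) b ≃ᵘ mkℚᵘ (+ c) d
mkℚᵘ-cross a b c d eq = *≡* (trans (sym (ℤ.pos-* a (suc d))) (trans (cong +_ eq) (ℤ.pos-* c (suc b))))

/-cross : ∀ a b c d → a * suc d ≡ c * suc b → + a / suc b ≡ + c / suc d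
/-cross a b c d eq = ℚ.fromℚᵘ-cong (mkℚᵘ-cross a b c d eq)

mkℚᵘ-+ : ∀ a c b → mkℚᵘ (+ a) b ℚᵘ.+ mkℚᵘ (+ c) b ≃ᵘ mkℚᵘ (+ (a + c)) b
mkℚᵘ-+ a c b = ℚᵘ.≃-trans (ℚᵘ.≃-reflexive (cong (λ n → mkℚᵘ n _) numerator)) (mkℚᵘ-cross _ _ _ _ cross)
  where
  l = suc b
  cross : (a * l + c * l) * l ≡ (a + c) * (l * l)
  cross = trans (cong (_* l) (sym (*-distribʳ-+ l a c))) (*-assoc (a + c) l l)
  numerator : + a ℤ.* + l ℤ.+ + c ℤ.* + l ≡ + (a * l + c * l)
  numerator = trans (cong₂ ℤ._+_ (sym (ℤ.pos-* a l)) (sym (ℤ.pos-* c l))) (sym (ℤ.pos-+ (a * l) (c * l)))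

Σℚ-common-denominator : ∀ {a} {A : Set a} b (f : A → ℕ) xs →
                        Σℚ (map (λ x → + f x / suc b) xs) ≡ + Σℕ (map f xs) / suc b
Σℚ-common-denominator b f xs =
  ℚ.toℚᵘ-injective (ℚᵘ.≃-trans (toℚᵘ-Σℚ xs) (ℚᵘ.≃-sym (ℚ.toℚᵘ-fromℚᵘ _)))
  where
  toℚᵘ-Σℚ : ∀ xs → toℚᵘ (Σℚ (map (λ x → + f x / suc b) xs)) ≃ᵘ mkℚᵘ (+ Σℕ (map f xs)) b
  toℚᵘ-Σℚ []       = *≡* refl
  toℚᵘ-Σℚ (x ∷ xs) = ℚᵘ.≃-trans (ℚ.toℚᵘ-homo-+ (+ f x / suc b) _)
    (ℚᵘ.≃-trans (ℚᵘ.+-cong (ℚ.toℚᵘ-fromℚᵘ (mkℚᵘ (+ f x) b)) (toℚᵘ-Σℚ xs)) (mkℚᵘ-+ (f x) _ b))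

1/l*t≡t/l : ∀ b t → (+ 1 / suc b) Data.Rational.* (+ t / 1) ≡ + t / suc b
1/l*t≡t/l b t = ℚ.toℚᵘ-injective (ℚᵘ.≃-trans (ℚ.toℚᵘ-homo-* (+ 1 / suc b) (+ t / 1))
  (ℚᵘ.≃-trans (ℚᵘ.*-cong (ℚ.toℚᵘ-fromℚᵘ (mkℚᵘ (+ 1) b)) (ℚ.toℚᵘ-fromℚᵘ (mkℚᵘ (+ t) 0)))
    (ℚᵘ.≃-trans (*≡* (cong₂ ℤ._*_ (ℤ.*-identityˡ (+ t)) (cong (λ n → + suc n) (sym (*-identityʳ b)))))
      (ℚᵘ.≃-sym (ℚ.toℚᵘ-fromℚᵘ (mkℚᵘ (+ t) b))))))

Σφ/ord≡Σgcd/ord : ∀ k m .{{_ : NonZero k}} .{{_ : NonZero m}} → Coprime m k →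
  Σℚ (map (λ d → (+ φ d) / ord k d) (divisors m))
    ≡ ((+ 1) / ord k m) Data.Rational.* ((+ Σℕ (map (λ j → gcd (k ^ j ∸ 1) m) (upTo (ord k m)))) / 1)
Σφ/ord≡Σgcd/ord k m m⊥k = begin
  Σℚ (map (λ d → + φ d / ord k d) (divisors m))  ≡⟨ cong Σℚ (map-cong-local (All.map rescale divisors∣m)) ⟩
  Σℚ (map (λ d → + G d / L) (divisors m))        ≡⟨ Σℚ-common-denominator (ord-1 k m) G (divisors m) ⟩
  + Σℕ (map G (divisors m)) / L                  ≡⟨ cong (λ t → + t / L) (Σgcd≡Σφ*[ord/ord] k m m⊥k) ⟨
  + T / L                                        ≡⟨ 1/l*t≡t/l (ord-1 k m) T ⟨
  (+ 1 / L) Data.Rational.* (+ T / 1)            ∎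
  where
  open ≡-Reasoning
  L = ord k m
  G = λ d → φ d * (L ℕ./ ord k d)
  T = Σℕ (map (λ j → gcd (k ^ j ∸ 1) m) (upTo L))
  divisors∣m = all-filter (_∣? m) (map suc (upTo m))
  rescale : ∀ {d} → d ∣ m → + φ d / ord k d ≡ + G d / L
  rescale {zero}  d∣m = contradiction (0∣⇒≡0 d∣m) (≢-nonZero⁻¹ m)
  rescale {suc d} d∣m = /-cross (φ (suc d)) _ (G (suc d)) _
    (trans (cong (φ (suc d) *_) (sym (m/n*n≡m (ord∣ord k m⊥k d∣m)))) (sym (*-assoc (φ (suc d)) _ _)))

coprime-*+1 : ∀ k n → Coprime (k * n + 1) k
coprime-*+1 k n (i∣kn+1 , i∣k) = ∣1⇒≡1 (∣m+n∣m⇒∣n i∣kn+1 (∣m⇒∣m*n n i∣k))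

-- The identity holds for every m coprime to k.
proposition3p2 : (k n : ℕ) → k ≥ 2 → n ≥ 1 →
    Σℚ (map (λ d → (+ φ d) / ord k d) (divisors (k Data.Nat.* n + 1)))
      ≡ ((+ 1) / ord k (k Data.Nat.* n + 1))
          Data.Rational.* ((+ Σℕ (map (λ j → gcd (k ^ j ∸ 1) (k Data.Nat.* n + 1)) (upTo (ord k (k Data.Nat.* n + 1))))) / 1)
proposition3p2 k n k≥2 _ =
  Σφ/ord≡Σgcd/ord k (k * n + 1) {{>-nonZero (<-≤-trans z<s k≥2)}} {{≢-nonZero (m+1+n≢0 (k * n))}} (coprime-*+1 k n)
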